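{- If $\Gamma$ is a simple cubic girth-regular graph of girth $g$ with signature $(0,1,1)$, then $\Gamma\cong\mathrm{Tr}(\Lambda,\leftrightarrow)$ for some $g$-regular graph $\Lambda$ (possibly with parallel edges) and some dihedral scheme $\leftrightarrow$ on $\Lambda$. Moreover, if $\Gamma$ is vertex-transitive, then the dihedral scheme $\leftrightarrow$ can be taken to be arc-transitive.
   Context: Cubic means $3$-regular. For a graph of finite girth $g$, a girth cycle is a cycle of length $g$, and $\epsilon(e)$ is the number of girth cycles containing the edge $e$. The signature of a vertex $v$ with incident edges $e_1,\ldots,e_k$ ordered so that $\epsilon(e_1)\le\cdots\le\epsilon(e_k)$ is $(\epsilon(e_1),\ldots,\epsilon(e_k))$; a graph is girth-regular if all vertices have the same signature (the signature of the graph). A graph with parallel edges and loops is a triple $(V,E,\partial)$ with $\partial:E\to\{X\subseteq V:|X|\le 2\}$ giving the end-vertices of each edge. Each edge consists of two mutually inverse arcs, each having one end-vertex as its tail; $A(\Lambda)$ is the set of arcs and $\mathrm{out}(u)$ the set of arcs with tail $u$. A dihedral scheme on $\Lambda$ is an irreflexive symmetric relation $\leftrightarrow$ on $A(\Lambda)$ such that the simple graph $(A(\Lambda),\leftrightarrow)$ is $2$-regular and its connected components are exactly the sets $\mathrm{out}(u)$. The truncation $\mathrm{Tr}(\Lambda,\leftrightarrow)$ is the simple graph with vertex set $A(\Lambda)$ in which arcs $s,t$ are adjacent iff $s\leftrightarrow t$ or $s,t$ are mutually inverse. The scheme is arc-transitive if the group of automorphisms of $\Lambda$ preserving $\leftrightarrow$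 is transitive on $A(\Lambda)$. -}

module Defs where

open import Data.Nat using (ℕ; zero; suc; _≤_; _<_; _∸_)
open import Data.Nat.Properties using (≤-decTotalOrder)
open import Data.Bool using (Bool; true; false; _∧_; _∨_; not; T; _xor_)
open import Data.Fin using (Fin; _≟_)
open import Data.List using (List; []; _∷_; length; filter; map; concatMap; allFin)
open import Data.Bool.ListAction using (any)
open import Data.Product using (Σ; _×_; _,_; proj₁; proj₂)
open import Relation.Nullary.Decidable using (⌊_⌋)
open import Relation.Binary.PropositionalEquality using (_≡_)
open import Relation.Binary.Construct.Closure.ReflexiveTransitive using (Star)
open import Function.Bundles using (Inverse; _↔_; _⇔_)
open import Data.Empty using (⊥)
open import Data.Bool.Properties using (T?)
open import Data.List.Sort.InsertionSort.Base ≤-decTotalOrder using (sort)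

record Graph (n : ℕ) : Set where
  field
    adj    : Fin n → Fin n → Bool
    sym    : ∀ x y → adj x y ≡ adj y x
    irrefl : ∀ x → adj x x ≡ false

module _ {n : ℕ} (Γ : Graph n) where
  open Graph Γ

  neighbours : Fin n → List (Fin n)
  neighbours v = filter (λ w → T? (adj v w)) (allFin n)

  Cubic : Set
  Cubic = ∀ v → length (neighbours v) ≡ 3

  allDistinct : List (Fin n) → Bool
  allDistinct []       = true
  allDistinct (x ∷ xs) = not (any (λ y → ⌊ x ≟ y ⌋) xs) ∧ allDistinct xs

  closesTo : Fin n → Fin n → List (Fin n) → Bool
  closesTo x₀ y []       = adj y x₀
  closesTo x₀ y (z ∷ zs) = adj y z ∧ closesTo x₀ z zs

  -- A list (x₀, …, x_{k-1}) with k ≥ 3, pairwise distinct entries and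
  -- x₀ ~ x₁ ~ … ~ x_{k-1} ~ x₀ : a cycle of length k given with a chosen
  -- starting vertex and direction.
  isCycle : List (Fin n) → Bool
  isCycle []                   = false
  isCycle (_ ∷ [])             = false
  isCycle (_ ∷ _ ∷ [])         = false
  isCycle (x ∷ y ∷ z ∷ zs)     = allDistinct (x ∷ y ∷ z ∷ zs) ∧ closesTo x x (y ∷ z ∷ zs)

  HasCycleOfLength : ℕ → Set
  HasCycleOfLength k = Σ (List (Fin n)) λ xs → length xs ≡ k × T (isCycle xs)

  Girth : ℕ → Set
  Girth g = HasCycleOfLength g × (∀ k → k < g → HasCycleOfLength k → ⊥)

  allLists : ℕ → List (List (Fin n))
  allLists zero    = [] ∷ []
  allLists (suc k) = concatMap (λ x → map (x ∷_) (allLists k)) (allFin n)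

  -- Each cycle C through uv has exactly one rotation/reflection written
  -- as a list starting u, v, …, so ε(uv) is the number of cycle-lists of
  -- length g starting with u , v.
  ε : ℕ → Fin n → Fin n → ℕ
  ε g u v = length (filter (λ xs → T? (isCycle xs))
                           (map (λ rest → u ∷ v ∷ rest) (allLists (g ∸ 2))))

  signature : ℕ → Fin n → List ℕ
  signature g v = sort (map (ε g v) (neighbours v))

  GirthRegularWithSignature : ℕ → List ℕ → Set
  GirthRegularWithSignature g sig = ∀ v → signature g v ≡ sig

  record Automorphism : Set where
    field
      perm     : Fin n ↔ Fin n
      preserve : ∀ x y → adj x y ≡ adj (Inverse.to perm x) (Inverse.to perm y)

  VertexTransitive : Set
  VertexTransitive = ∀ x y → Σ Automorphism λ φ → Inverse.to (Automorphism.perm φ) x ≡ y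

-- Vertices Fin nV, edges Fin nE; each edge e has two arcs (e , false)
-- and (e , true), with tails proj₁ (ends e) and proj₂ (ends e)
-- respectively; a loop is an edge with equal ends (it still has two
-- mutually inverse arcs, both with the same tail).

record MultiGraph : Set where
  field
    nV   : ℕ
    nE   : ℕ
    ends : Fin nE → Fin nV × Fin nV

module _ (Λ : MultiGraph) where
  open MultiGraph Λ

  Arc : Set
  Arc = Fin nE × Bool

  tail : Arc → Fin nV
  tail (e , false) = proj₁ (ends e)
  tail (e , true)  = proj₂ (ends e)

  inv : Arc → Arc
  inv (e , b) = (e , not b)

  allArcs : List Arc
  allArcs = concatMap (λ e → (e , false) ∷ (e , true) ∷ []) (allFin nE)

  outDegree : Fin nV → ℕ
  outDegree u = length (filter (λ s → tail s ≟ u) allArcs)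

  Regular : ℕ → Set
  Regular k = ∀ u → outDegree u ≡ k

  areInverse : Arc → Arc → Bool
  areInverse (e , b) (e' , b') = ⌊ e ≟ e' ⌋ ∧ (b xor b')

  record DihedralScheme : Set where
    field
      rel        : Arc → Arc → Bool
      irrefl     : ∀ s → rel s s ≡ false
      sym        : ∀ s t → rel s t ≡ rel t s
      twoRegular : ∀ s → length (filter (λ t → T? (rel s t)) allArcs) ≡ 2
      components : ∀ s t → Star (λ a b → T (rel a b)) s t ⇔ (tail s ≡ tail t)

  trAdj : DihedralScheme → Arc → Arc → Bool
  trAdj D s t = DihedralScheme.rel D s t ∨ areInverse s t

  record SchemeAutomorphism (D : DihedralScheme) : Set where
    field
      onArcs     : Arc ↔ Arc
      onVertices : Fin nV ↔ Fin nV
      tailComm   : ∀ s → tail (Inverse.to onArcs s) ≡ Inverse.to onVertices (tail s)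
      invComm    : ∀ s → Inverse.to onArcs (inv s) ≡ inv (Inverse.to onArcs s)
      preserve   : ∀ s t → DihedralScheme.rel D s t
                           ≡ DihedralScheme.rel D (Inverse.to onArcs s) (Inverse.to onArcs t)

  ArcTransitive : DihedralScheme → Set
  ArcTransitive D = ∀ s t → Σ (SchemeAutomorphism D) λ φ →
                      Inverse.to (SchemeAutomorphism.onArcs φ) s ≡ t

IsoToTruncation : {n : ℕ} → Graph n → (Λ : MultiGraph) → DihedralScheme Λ → Set
IsoToTruncation {n} Γ Λ D =
  Σ (Fin n ↔ Arc Λ) λ f →
    ∀ x y → Graph.adj Γ x y ≡ trAdj Λ D (Inverse.to f x) (Inverse.to f y)

TruncationOfRegular : {n : ℕ} → Graph n → ℕ → Set
TruncationOfRegular Γ g =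
  Σ MultiGraph λ Λ → Regular Λ g × Σ (DihedralScheme Λ) λ D → IsoToTruncation Γ Λ D

ArcTransitiveTruncationOfRegular : {n : ℕ} → Graph n → ℕ → Set
ArcTransitiveTruncationOfRegular Γ g =
  Σ MultiGraph λ Λ → Regular Λ g × Σ (DihedralScheme Λ) λ D →
    ArcTransitive Λ D × IsoToTruncation Γ Λ D

module Submission where

-- Call an edge of Γ a girth edge if it lies on a girth cycle.  By the
-- signature, every vertex x has exactly two girth edges, to p x and q x, and one
-- further edge, to its mate.  A girth cycle through x therefore contains both
-- girth neighbours of x, so the girth cycles are exactly the classes of
-- "joined by a path of girth edges"; they partition V(Γ) into cycles of length g.
-- The mate map is a fixed-point-free involution.  Λ has the girth cycles as
-- vertices and the mate edges {x, mate x} as edges, so the vertex x of Γ is the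
-- arc of {x, mate x} leaving the cycle of x; two arcs are related by the scheme
-- iff the corresponding vertices form a girth edge.  Every automorphism of Γ
-- preserves girth edges and commutes with the mate map, hence induces an
-- automorphism of (Λ, ↔) acting on arcs as it acts on V(Γ).

open import Defs
open import Data.Nat using (ℕ; zero; suc; _≤_; _<_; _∸_; _<ᵇ_; z≤n; s≤s)
open import Data.Nat.Properties using (suc-injective; <ᵇ⇒<; <⇒<ᵇ; ≮⇒≥; ≤∧≢⇒<; <-asym; <-irrefl; ≤-decTotalOrder)
open import Data.Bool using (Bool; true; false; T; not; if_then_else_)
open import Data.Bool.Properties using (T?; T-irrelevant; T-∧; T-∨)
open import Data.Bool.ListAction using (any)
open import Data.Empty using (⊥; ⊥-elim)
open import Data.Fin using (Fin; toℕ; _≟_) renaming (zero to fzero; suc to fsuc)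
open import Data.Fin.Properties using (toℕ-injective)
open import Data.List using (List; []; _∷_; _++_; _∷ʳ_; length; map; reverse; filter; allFin; concatMap; cartesianProduct)
open import Data.List.Properties using (++-assoc; ++-identityʳ; length-map; map-++; length-reverse; reverse-++)
open import Data.List.Membership.Propositional using (_∈_; lose)
open import Data.List.Membership.Propositional.Properties using (∈-allFin; ∈-concatMap⁺; ∈-concatMap⁻; ∈-map⁺; ∈-map⁻; ∈-filter⁺; ∈-filter⁻; ∈-++⁺ʳ; ∈-∃++; ∈-cartesianProduct⁺)
open import Data.List.Membership.Propositional.Properties.WithK using (unique∧set⇒bag)
open import Data.List.Relation.Binary.BagAndSetEquality using (∼bag⇒↭)
open import Data.List.Relation.Binary.Permutation.Propositional using (_↭_; ↭-refl; ↭-prep; ↭-sym; ↭⇒↭ₛ)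
open import Data.List.Relation.Binary.Permutation.Propositional.Properties using (↭-length; ∈-resp-↭; ++-comm; ↭-reverse; shift)
import Data.List.Relation.Binary.Permutation.Setoid.Properties as Permₛ
open import Data.List.Relation.Unary.All as All using (All; []; _∷_)
open import Data.List.Relation.Unary.Any using (here; there; satisfied)
open import Data.List.Relation.Unary.Linked as Linked using (Linked; []; [-]; _∷_)
import Data.List.Relation.Unary.Linked.Properties as Linkedₚ
open import Data.List.Relation.Unary.Unique.Propositional using (Unique; []; _∷_)
import Data.List.Relation.Unary.Unique.Propositional.Properties as Unique
open import Data.List.Reverse using ([]; _∶_∶ʳ_; reverseView)
open import Data.List.Sort.InsertionSort.Base ≤-decTotalOrder using (sort)
open import Data.List.Sort.InsertionSort.Properties ≤-decTotalOrder using (sort-↭)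
open import Data.Product using (Σ; _×_; _,_; proj₁; proj₂)
open import Data.Sum using (_⊎_; inj₁; inj₂)
import Data.Sum as Sum
open import Function using (_∘_; flip)
open import Function.Bundles using (_⇔_; mk⇔; Equivalence; _↔_; Inverse; Injection; mk↔ₛ′)
open import Function.Properties.Inverse using (↔⇒↣)
open import Function.Construct.Composition using (_↔-∘_; _⇔-∘_)
open import Function.Construct.Symmetry using (↔-sym; ⇔-sym)
open import Relation.Binary.Construct.Closure.ReflexiveTransitive using (Star; _◅_; _◅◅_; gmap) renaming (ε to done)
import Relation.Binary.Construct.Closure.ReflexiveTransitive as Star
open import Relation.Binary.Structures using (IsEquivalence)
open import Relation.Binary.PropositionalEquality using (_≡_; _≢_; refl; sym; trans; cong; cong₂; subst; subst₂; setoid; module ≡-Reasoning)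
open import Relation.Nullary using (Dec; yes; no; ¬_)
open import Relation.Nullary.Decidable using (⌊_⌋; fromWitness; toWitness)
import Relation.Nullary.Decidable as Dec
open import Relation.Unary using (Decidable)

length-unique-≡ : {A : Set} {xs ys : List A} → Unique xs → Unique ys →
                  (∀ {z} → z ∈ xs ⇔ z ∈ ys) → length xs ≡ length ys
length-unique-≡ ux uy same = ↭-length (∼bag⇒↭ (unique∧set⇒bag ux uy same))

unique-resp-↭ : {A : Set} {xs ys : List A} → xs ↭ ys → Unique xs → Unique ys
unique-resp-↭ {A} p = Permₛ.Unique-resp-↭ (setoid A) (↭⇒↭ₛ p)

nonempty⇒member : {A : Set} (xs : List A) → 0 < length xs → Σ A (_∈ xs)
nonempty⇒member (x ∷ _) _ = x , here refl

member⇒nonempty : {A : Set} {z : A} {xs : List A} → z ∈ xs → 0 < length xs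
member⇒nonempty {xs = _ ∷ _} _ = s≤s z≤n

first : {A : Set} → (A → Bool) → A → List A → A
first p d []       = d
first p d (y ∷ ys) = if p y then y else first p d ys

first-sat : {A : Set} (p : A → Bool) (d : A) {z : A} (ys : List A) → z ∈ ys → T (p z) →
            T (p (first p d ys))
first-sat p d (y ∷ ys) z∈ pz with p y in py
... | true = subst T (sym py) _
first-sat p d (y ∷ ys) (here refl) pz | false = ⊥-elim (subst T py pz)
first-sat p d (y ∷ ys) (there z∈) pz | false = first-sat p d ys z∈ pz

first-cong : {A : Set} (p p′ : A → Bool) (d d′ : A) {z : A} (ys : List A) → (∀ y → p y ≡ p′ y) →
             z ∈ ys → T (p z) → first p d ys ≡ first p′ d′ ys
first-cong p p′ d d′ (y ∷ ys) p≗p′ z∈ pz with p y in py | p′ y in p′y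
... | true  | true  = refl
... | true  | false = ⊥-elim (subst T (trans (sym py) (trans (p≗p′ y) p′y)) _)
... | false | true  = ⊥-elim (subst T (trans (sym p′y) (trans (sym (p≗p′ y)) py)) _)
first-cong p p′ d d′ (y ∷ ys) p≗p′ (here refl) pz | false | false = ⊥-elim (subst T py pz)
first-cong p p′ d d′ (y ∷ ys) p≗p′ (there z∈) pz | false | false = first-cong p p′ d d′ ys p≗p′ z∈ pz

T-⇔⇒≡ : ∀ {a b : Bool} → T a ⇔ T b → a ≡ b
T-⇔⇒≡ {false} {false} _   = refl
T-⇔⇒≡ {false} {true}  a⇔b = ⊥-elim (Equivalence.from a⇔b _)
T-⇔⇒≡ {true}  {false} a⇔b = ⊥-elim (Equivalence.to a⇔b _)
T-⇔⇒≡ {true}  {true}  _   = refl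

linked-∷ʳ : {A : Set} {R : A → A → Set} (xs : List A) {y z : A} →
            Linked R (xs ∷ʳ y) → R y z → Linked R (xs ∷ʳ y ∷ʳ z)
linked-∷ʳ []               [-]       r = r ∷ [-]
linked-∷ʳ (x ∷ [])         (s ∷ [-]) r = s ∷ r ∷ [-]
linked-∷ʳ (x ∷ x′ ∷ xs)    (s ∷ l)   r = s ∷ linked-∷ʳ (x′ ∷ xs) l r

linked-reverse : {A : Set} {R : A → A → Set} {xs : List A} →
                 Linked R xs → Linked (flip R) (reverse xs)
linked-reverse []                       = []
linked-reverse [-]                      = [-]
linked-reverse {xs = x ∷ y ∷ ys} (r ∷ l) =
  subst (Linked _) (sym (reverse-++ (x ∷ []) (y ∷ ys)))
    (subst (λ zs → Linked _ (zs ∷ʳ x)) (sym (reverse-++ (y ∷ []) ys))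
      (linked-∷ʳ (reverse ys)
        (subst (Linked _) (reverse-++ (y ∷ []) ys) (linked-reverse l)) r))

sorted-011 : ∀ a b c → sort (a ∷ b ∷ c ∷ []) ≡ 0 ∷ 1 ∷ 1 ∷ [] →
             (a ≡ 0 × b ≡ 1 × c ≡ 1) ⊎ (b ≡ 0 × a ≡ 1 × c ≡ 1) ⊎ (c ≡ 0 × a ≡ 1 × b ≡ 1)
sorted-011 a b c sorted = cases (zeroOrOne (here refl)) (zeroOrOne (there (here refl)))
                                (zeroOrOne (there (there (here refl)))) sorted
  where
  zeroOrOne : ∀ {e} → e ∈ a ∷ b ∷ c ∷ [] → e ≡ 0 ⊎ e ≡ 1
  zeroOrOne e∈ with subst (_ ∈_) sorted (∈-resp-↭ (↭-sym (sort-↭ (a ∷ b ∷ c ∷ []))) e∈)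
  ... | here e≡0                 = inj₁ e≡0
  ... | there (here e≡1)         = inj₂ e≡1
  ... | there (there (here e≡1)) = inj₂ e≡1
  cases : a ≡ 0 ⊎ a ≡ 1 → b ≡ 0 ⊎ b ≡ 1 → c ≡ 0 ⊎ c ≡ 1 → sort (a ∷ b ∷ c ∷ []) ≡ 0 ∷ 1 ∷ 1 ∷ [] →
          (a ≡ 0 × b ≡ 1 × c ≡ 1) ⊎ (b ≡ 0 × a ≡ 1 × c ≡ 1) ⊎ (c ≡ 0 × a ≡ 1 × b ≡ 1)
  cases (inj₁ refl) (inj₂ refl) (inj₂ refl) _ = inj₁ (refl , refl , refl)
  cases (inj₂ refl) (inj₁ refl) (inj₂ refl) _ = inj₂ (inj₁ (refl , refl , refl))
  cases (inj₂ refl) (inj₂ refl) (inj₁ refl) _ = inj₂ (inj₂ (refl , refl , refl))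
  cases (inj₁ refl) (inj₁ refl) (inj₁ refl) ()
  cases (inj₁ refl) (inj₁ refl) (inj₂ refl) ()
  cases (inj₁ refl) (inj₂ refl) (inj₁ refl) ()
  cases (inj₂ refl) (inj₁ refl) (inj₁ refl) ()
  cases (inj₂ refl) (inj₂ refl) (inj₂ refl) ()

two-distinct-exhaust : {A : Set} {P Q u v z : A} → u ≡ P ⊎ u ≡ Q → v ≡ P ⊎ v ≡ Q → u ≢ v →
                       z ≡ P ⊎ z ≡ Q → z ≡ u ⊎ z ≡ v
two-distinct-exhaust (inj₁ refl) (inj₁ refl) u≢v _           = ⊥-elim (u≢v refl)
two-distinct-exhaust (inj₂ refl) (inj₂ refl) u≢v _           = ⊥-elim (u≢v refl)
two-distinct-exhaust (inj₁ refl) (inj₂ refl) _   (inj₁ refl) = inj₁ refl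
two-distinct-exhaust (inj₁ refl) (inj₂ refl) _   (inj₂ refl) = inj₂ refl
two-distinct-exhaust (inj₂ refl) (inj₁ refl) _   (inj₁ refl) = inj₂ refl
two-distinct-exhaust (inj₂ refl) (inj₁ refl) _   (inj₂ refl) = inj₁ refl

module Enumeration where
  addIf : Bool → ℕ → ℕ
  addIf true  k = suc k
  addIf false k = k

  count : ∀ {n} → (Fin n → Bool) → ℕ
  count {zero}  p = 0
  count {suc n} p = addIf (p fzero) (count (p ∘ fsuc))

  index : ∀ {n} (p : Fin n → Bool) (x : Fin n) → T (p x) → Fin (count p)
  index {suc n} p fzero    px with p fzero
  ... | true  = fzero
  index {suc n} p (fsuc x) px with p fzero
  ... | true  = fsuc (index (p ∘ fsuc) x px)
  ... | false = index (p ∘ fsuc) x px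

  element : ∀ {n} (p : Fin n → Bool) → Fin (count p) → Fin n
  element {suc n} p i with p fzero
  element {suc n} p fzero    | true  = fzero
  element {suc n} p (fsuc i) | true  = fsuc (element (p ∘ fsuc) i)
  ... | false = fsuc (element (p ∘ fsuc) i)

  element-sat : ∀ {n} (p : Fin n → Bool) (i : Fin (count p)) → T (p (element p i))
  element-sat {suc n} p i with p fzero in eq
  element-sat {suc n} p fzero    | true rewrite eq = _
  element-sat {suc n} p (fsuc i) | true  = element-sat (p ∘ fsuc) i
  ... | false = element-sat (p ∘ fsuc) i

  element-index : ∀ {n} (p : Fin n → Bool) (x : Fin n) (px : T (p x)) →
                  element p (index p x px) ≡ x
  element-index {suc n} p fzero    px with p fzero
  ... | true  = refl
  element-index {suc n} p (fsuc x) px with p fzero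
  ... | true  = cong fsuc (element-index (p ∘ fsuc) x px)
  ... | false = cong fsuc (element-index (p ∘ fsuc) x px)

  -- Stated for any x equal to element p i, so that the proof of T (p x)
  -- can be abstracted together with p fzero.
  index-element : ∀ {n} (p : Fin n → Bool) (i : Fin (count p)) {x : Fin n} →
                  x ≡ element p i → (px : T (p x)) → index p x px ≡ i
  index-element {suc n} p i {fzero} e px with p fzero
  index-element {suc n} p fzero    {fzero} refl px | true = refl
  index-element {suc n} p (fsuc i) {fzero} ()   px | true
  index-element {suc n} p i        {fzero} ()   px | false
  index-element {suc n} p i {fsuc x} e px with p fzero
  index-element {suc n} p fzero    {fsuc x} ()   px | true
  index-element {suc n} p (fsuc i) {fsuc x} refl px | true = cong fsuc (index-element (p ∘ fsuc) i refl px)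
  index-element {suc n} p i        {fsuc x} refl px | false = index-element (p ∘ fsuc) i refl px

  index-cong : ∀ {n} (p : Fin n → Bool) {x y : Fin n} (px : T (p x)) (py : T (p y)) →
               x ≡ y → index p x px ≡ index p y py
  index-cong p px py refl = cong (index p _) (T-irrelevant px py)

-- The classes of a decidable equivalence relation on Fin n are numbered by
-- Fin classes; each class is represented by its first element.
module Quotient {n : ℕ} {_≈_ : Fin n → Fin n → Set} (isEquivalence : IsEquivalence _≈_)
                (_≈?_ : ∀ x y → Dec (x ≈ y)) where
  open IsEquivalence isEquivalence renaming (refl to ≈-refl; sym to ≈-sym; trans to ≈-trans)
  open Enumeration

  -- Opaque, so that the type checker never computes representatives.
  opaque
    canon : Fin n → Fin n
    canon x = first (λ y → ⌊ x ≈? y ⌋) x (allFin n)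

    canon-≈ : ∀ x → x ≈ canon x
    canon-≈ x = toWitness (first-sat (λ y → ⌊ x ≈? y ⌋) x (allFin n) (∈-allFin x) (fromWitness ≈-refl))

    canon-cong : ∀ {x y} → x ≈ y → canon x ≡ canon y
    canon-cong {x} {y} x≈y = first-cong _ _ x y (allFin n) sameClass (∈-allFin x) (fromWitness ≈-refl)
      where
      sameClass : ∀ z → ⌊ x ≈? z ⌋ ≡ ⌊ y ≈? z ⌋
      sameClass z = T-⇔⇒≡ (mk⇔ (λ t → fromWitness (≈-trans (≈-sym x≈y) (toWitness t)))
                                (λ t → fromWitness (≈-trans x≈y (toWitness t))))

    isCanon : Fin n → Bool
    isCanon r = ⌊ canon r ≟ r ⌋

    classes : ℕ
    classes = count isCanon

    [_] : Fin n → Fin classes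
    [ x ] = index isCanon (canon x) (fromWitness (sym (canon-cong (canon-≈ x))))

    choose : Fin classes → Fin n
    choose = element isCanon

    choose-[] : ∀ x → choose [ x ] ≈ x
    choose-[] x = subst (_≈ x) (sym (element-index isCanon (canon x) _)) (≈-sym (canon-≈ x))

    []-choose : ∀ u → [ choose u ] ≡ u
    []-choose u = index-element isCanon u (toWitness (element-sat isCanon u)) _

    []-cong : ∀ {x y} → x ≈ y → [ x ] ≡ [ y ]
    []-cong x≈y = index-cong isCanon _ _ (canon-cong x≈y)

    []-injective : ∀ {x y} → [ x ] ≡ [ y ] → x ≈ y
    []-injective {x} {y} eq =
      ≈-trans (≈-sym (choose-[] x)) (subst (_≈ y) (cong choose (sym eq)) (choose-[] y))

-- A fixed-point-free involution m of Fin n splits Fin n into pairs {x, m x};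
-- numbering the pairs by their smaller element gives Fin n ↔ Fin pairs × Bool,
-- where flipping the Bool applies m.
module InvolutionPairing {n : ℕ} (m : Fin n → Fin n) (m-involutive : ∀ x → m (m x) ≡ x)
                         (m-fixfree : ∀ x → m x ≢ x) where
  open Enumeration

  isLower : Fin n → Bool
  isLower x = toℕ x <ᵇ toℕ (m x)

  mate-isLower : ∀ {x} → ¬ T (isLower x) → T (isLower (m x))
  mate-isLower {x} ¬lo = <⇒<ᵇ (subst (λ y → toℕ (m x) < toℕ y) (sym (m-involutive x))
    (≤∧≢⇒< (≮⇒≥ (¬lo ∘ <⇒<ᵇ)) (m-fixfree x ∘ toℕ-injective)))

  pairs : ℕ
  pairs = count isLower

  lowerOf : Fin pairs → Fin n
  lowerOf = element isLower

  unpair : Fin pairs × Bool → Fin n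
  unpair (e , false) = lowerOf e
  unpair (e , true)  = m (lowerOf e)

  pair : Fin n → Fin pairs × Bool
  pair x with T? (isLower x)
  ... | yes lo = index isLower x lo , false
  ... | no ¬lo = index isLower (m x) (mate-isLower ¬lo) , true

  unpair-pair : ∀ x → unpair (pair x) ≡ x
  unpair-pair x with T? (isLower x)
  ... | yes lo = element-index isLower x lo
  ... | no ¬lo = trans (cong m (element-index isLower (m x) _)) (m-involutive x)

  pair-unpair : ∀ s → pair (unpair s) ≡ s
  pair-unpair (e , false) with T? (isLower (lowerOf e))
  ... | yes lo = cong (_, false) (index-element isLower e refl lo)
  ... | no ¬lo = ⊥-elim (¬lo (element-sat isLower e))
  pair-unpair (e , true) with T? (isLower (m (lowerOf e)))
  ... | yes lo = ⊥-elim (<-asym (<ᵇ⇒< _ _ (element-sat isLower e))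
                   (subst (λ y → toℕ (m (lowerOf e)) < toℕ y) (m-involutive (lowerOf e)) (<ᵇ⇒< _ _ lo)))
  ... | no ¬lo = cong (_, true) (index-element isLower e (m-involutive (lowerOf e)) _)

  pairing : Fin n ↔ (Fin pairs × Bool)
  pairing = mk↔ₛ′ pair unpair pair-unpair unpair-pair

  unpair-flip : ∀ e b → unpair (e , not b) ≡ m (unpair (e , b))
  unpair-flip e false = refl
  unpair-flip e true  = sym (m-involutive (lowerOf e))

-- Arcs of a multigraph: allArcs lists every arc exactly once, so arcs
-- with a property can be counted through any bijection with Fin n.
module ArcCounting (Λ : MultiGraph) where
  open MultiGraph Λ using (nE)

  bothArcs : Fin nE → List (Arc Λ)
  bothArcs e = (e , false) ∷ (e , true) ∷ []

  allArcs-product : ∀ es → concatMap bothArcs es ≡ cartesianProduct es (false ∷ true ∷ [])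
  allArcs-product []       = refl
  allArcs-product (e ∷ es) = cong (λ l → (e , false) ∷ (e , true) ∷ l) (allArcs-product es)

  ∈-allArcs : ∀ s → s ∈ allArcs Λ
  ∈-allArcs (e , b) = subst ((e , b) ∈_) (sym (allArcs-product (allFin nE)))
                        (∈-cartesianProduct⁺ (∈-allFin e) (∈-bools b))
    where
    ∈-bools : ∀ b → b ∈ false ∷ true ∷ []
    ∈-bools false = here refl
    ∈-bools true  = there (here refl)

  allArcs-unique : Unique (allArcs Λ)
  allArcs-unique = subst Unique (sym (allArcs-product (allFin nE)))
    (Unique.cartesianProduct⁺ (Unique.allFin⁺ nE) (((λ ()) ∷ []) ∷ [] ∷ []))

  count-arcs : ∀ {n} (F : Fin n ↔ Arc Λ) {P : Arc Λ → Set} (P? : Decidable P)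
               {ys : List (Fin n)} → Unique ys → (∀ {x} → P (Inverse.to F x) ⇔ x ∈ ys) →
               length (filter P? (allArcs Λ)) ≡ length ys
  count-arcs F {P} P? {ys} uniq P⇔∈ =
    trans (length-unique-≡ (Unique.filter⁺ P? allArcs-unique) (Unique.map⁺ (Injection.injective (↔⇒↣ F)) uniq) same)
          (length-map (Inverse.to F) ys)
    where
    open Inverse F using (to; strictlyInverseˡ)
    same : ∀ {s} → s ∈ filter P? (allArcs Λ) ⇔ s ∈ map to ys
    same {s} = mk⇔
      (λ s∈ → subst (_∈ map to ys) (strictlyInverseˡ s)
                (∈-map⁺ to (Equivalence.to P⇔∈ (subst P (sym (strictlyInverseˡ s))
                  (proj₂ (∈-filter⁻ P? {xs = allArcs Λ} s∈))))))
      (λ s∈ → let x , x∈ , s≡ = ∈-map⁻ to s∈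
              in ∈-filter⁺ P? (∈-allArcs s) (subst P (sym s≡) (Equivalence.from P⇔∈ x∈)))

  areInverse⇔ : ∀ s t → T (areInverse Λ s t) ⇔ t ≡ inv Λ s
  areInverse⇔ (e , b) (e′ , b′) with e ≟ e′
  ... | no e≢e′   = mk⇔ (λ ()) (λ { refl → e≢e′ refl })
  areInverse⇔ (e , false) (.e , false) | yes refl = mk⇔ (λ ()) (λ ())
  areInverse⇔ (e , false) (.e , true)  | yes refl = mk⇔ (λ _ → refl) (λ _ → _)
  areInverse⇔ (e , true)  (.e , false) | yes refl = mk⇔ (λ _ → refl) (λ _ → _)
  areInverse⇔ (e , true)  (.e , true)  | yes refl = mk⇔ (λ ()) (λ ())

module Cycles {n : ℕ} (Γ : Graph n) where
  open Graph Γ renaming (sym to adj-sym)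

  V : Set
  V = Fin n

  _~_ : V → V → Set
  x ~ y = T (adj x y)

  ~-sym : ∀ {x y} → x ~ y → y ~ x
  ~-sym {x} {y} = subst T (adj-sym x y)

  ClosedWalk : List V → Set
  ClosedWalk []       = ⊥
  ClosedWalk (x ∷ xs) = Linked _~_ (x ∷ xs ∷ʳ x)

  Cycle : List V → Set
  Cycle Z = 3 ≤ length Z × Unique Z × ClosedWalk Z

  notAny⇔ : ∀ x (xs : List V) → T (not (any (λ y → ⌊ x ≟ y ⌋) xs)) ⇔ All (x ≢_) xs
  notAny⇔ x []       = mk⇔ (λ _ → []) (λ _ → _)
  notAny⇔ x (y ∷ ys) with x ≟ y
  ... | yes x≡y = mk⇔ (λ ()) (λ { (x≢y ∷ _) → x≢y x≡y })
  ... | no  x≢y = mk⇔ (λ t → x≢y ∷ Equivalence.to (notAny⇔ x ys) t)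
                      (λ { (_ ∷ a) → Equivalence.from (notAny⇔ x ys) a })

  allDistinct⇔ : ∀ xs → T (allDistinct Γ xs) ⇔ Unique xs
  allDistinct⇔ []       = mk⇔ (λ _ → []) (λ _ → _)
  allDistinct⇔ (x ∷ xs) = mk⇔
    (λ t → let a , d = Equivalence.to T-∧ t
           in Equivalence.to (notAny⇔ x xs) a ∷ Equivalence.to (allDistinct⇔ xs) d)
    (λ { (a ∷ u) → Equivalence.from T-∧
           (Equivalence.from (notAny⇔ x xs) a , Equivalence.from (allDistinct⇔ xs) u) })

  closesTo⇔ : ∀ x₀ y zs → T (closesTo Γ x₀ y zs) ⇔ Linked _~_ (y ∷ zs ∷ʳ x₀)
  closesTo⇔ x₀ y []       = mk⇔ (_∷ [-]) Linked.head
  closesTo⇔ x₀ y (z ∷ zs) = mk⇔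
    (λ t → let a , c = Equivalence.to T-∧ t in a ∷ Equivalence.to (closesTo⇔ x₀ z zs) c)
    (λ { (a ∷ l) → Equivalence.from T-∧ (a , Equivalence.from (closesTo⇔ x₀ z zs) l) })

  isCycle⇔ : ∀ Z → T (isCycle Γ Z) ⇔ Cycle Z
  isCycle⇔ []           = mk⇔ (λ ()) (λ { (() , _) })
  isCycle⇔ (_ ∷ [])     = mk⇔ (λ ()) (λ { (s≤s () , _) })
  isCycle⇔ (_ ∷ _ ∷ []) = mk⇔ (λ ()) (λ { (s≤s (s≤s ()) , _) })
  isCycle⇔ Z@(x ∷ y ∷ z ∷ zs) = mk⇔
    (λ t → let d , c = Equivalence.to T-∧ t
           in s≤s (s≤s (s≤s z≤n)) , Equivalence.to (allDistinct⇔ Z) d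
              , Equivalence.to (closesTo⇔ x x (y ∷ z ∷ zs)) c)
    (λ { (_ , u , w) → Equivalence.from T-∧
           (Equivalence.from (allDistinct⇔ Z) u , Equivalence.from (closesTo⇔ x x (y ∷ z ∷ zs)) w) })

  closedWalk-rotate₁ : ∀ x xs → ClosedWalk (x ∷ xs) → ClosedWalk (xs ∷ʳ x)
  closedWalk-rotate₁ x []       w       = w
  closedWalk-rotate₁ x (y ∷ ys) (r ∷ w) = linked-∷ʳ (y ∷ ys) w r

  closedWalk-rotate : ∀ A w B → ClosedWalk (A ++ w ∷ B) → ClosedWalk (w ∷ B ++ A)
  closedWalk-rotate []      w B cw = subst (λ l → ClosedWalk (w ∷ l)) (sym (++-identityʳ B)) cw
  closedWalk-rotate (a ∷ A) w B cw =
    subst (λ l → ClosedWalk (w ∷ l)) (++-assoc B (a ∷ []) A)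
      (closedWalk-rotate A w (B ∷ʳ a)
        (subst ClosedWalk (++-assoc A (w ∷ B) (a ∷ [])) (closedWalk-rotate₁ a (A ++ w ∷ B) cw)))

  cycle-rotate : ∀ A w B → Cycle (A ++ w ∷ B) → Cycle (w ∷ B ++ A)
  cycle-rotate A w B (len , u , cw) =
    subst (3 ≤_) (↭-length rotation) len , unique-resp-↭ rotation u , closedWalk-rotate A w B cw
    where
    rotation : A ++ w ∷ B ↭ w ∷ B ++ A
    rotation = ++-comm A (w ∷ B)

  cycle-reverse : ∀ y l → Cycle (y ∷ l) → Cycle (y ∷ reverse l)
  cycle-reverse y l (len , u , cw) =
    subst (3 ≤_) (↭-length reversal) len , unique-resp-↭ reversal u ,
    Linked.map ~-sym (subst (Linked _) reverse-walk (linked-reverse cw))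
    where
    reversal : y ∷ l ↭ y ∷ reverse l
    reversal = ↭-prep y (↭-sym (↭-reverse l))
    reverse-walk : reverse (y ∷ l ∷ʳ y) ≡ y ∷ reverse l ∷ʳ y
    reverse-walk = trans (reverse-++ (y ∷ []) (l ∷ʳ y)) (cong (_∷ʳ y) (reverse-++ l (y ∷ [])))

  cycle-map : (k : V → V) → (∀ {x y} → k x ≡ k y → x ≡ y) → (∀ {x y} → x ~ y → k x ~ k y) →
              ∀ {Z} → Cycle Z → Cycle (map k Z)
  cycle-map k inj hom {x ∷ xs} (len , u , cw) =
    subst (3 ≤_) (sym (length-map k (x ∷ xs))) len ,
    Unique.map⁺ inj u ,
    subst (Linked _~_) (map-++ k (x ∷ xs) (x ∷ [])) (Linkedₚ.map⁺ (Linked.map hom cw))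

  module _ (φ : Automorphism Γ) where
    open Inverse (Automorphism.perm φ) using (to; from; strictlyInverseˡ)

    automorphism-hom : ∀ {x y} → x ~ y → to x ~ to y
    automorphism-hom {x} {y} = subst T (Automorphism.preserve φ x y)

    automorphism-injective : ∀ {x y} → to x ≡ to y → x ≡ y
    automorphism-injective = Injection.injective (↔⇒↣ (Automorphism.perm φ))

    inverseAutomorphism : Automorphism Γ
    inverseAutomorphism = record
      { perm     = ↔-sym (Automorphism.perm φ)
      ; preserve = λ x y → sym (trans (Automorphism.preserve φ (from x) (from y))
                                      (cong₂ adj (strictlyInverseˡ x) (strictlyInverseˡ y))) }

∈-allLists⇔ : ∀ {n} (Γ : Graph n) k {r : List (Fin n)} → r ∈ allLists Γ k ⇔ length r ≡ k
∈-allLists⇔ {n} Γ k = mk⇔ (sound k) complete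
  where
  sound : ∀ k {r} → r ∈ allLists Γ k → length r ≡ k
  sound zero    (here refl) = refl
  sound (suc k) r∈ with satisfied (∈-concatMap⁻ (λ x → map (x ∷_) (allLists Γ k)) {xs = allFin n} r∈)
  ... | a , r∈a with ∈-map⁻ (a ∷_) r∈a
  ... | r′ , r′∈ , refl = cong suc (sound k r′∈)
  complete : ∀ {r} → length r ≡ k → r ∈ allLists Γ k
  complete {r} refl = complete′ r
    where
    complete′ : ∀ r → r ∈ allLists Γ (length r)
    complete′ []      = here refl
    complete′ (a ∷ r) = ∈-concatMap⁺ (λ x → map (x ∷_) (allLists Γ (length r)))
                          (lose (∈-allFin a) (∈-map⁺ (a ∷_) (complete′ r)))

module GirthCycles {n : ℕ} (Γ : Graph n) (g : ℕ) where
  open Cycles Γ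

  -- Girth cycles are listed with 2 + (g ∸ 2) entries, the length counted by ε.
  GirthCycle : List V → Set
  GirthCycle Z = Cycle Z × length Z ≡ suc (suc (g ∸ 2))

  -- The length 2 + (g ∸ 2) is g, since a cycle has at least three vertices.
  girthCycle-length : ∀ {Z} → GirthCycle Z → length Z ≡ g
  girthCycle-length ((three≤ , _) , len) = trans len (twoPlus g (subst (3 ≤_) len three≤))
    where
    twoPlus : ∀ g → 3 ≤ suc (suc (g ∸ 2)) → suc (suc (g ∸ 2)) ≡ g
    twoPlus zero          (s≤s (s≤s ()))
    twoPlus (suc zero)    (s≤s (s≤s ()))
    twoPlus (suc (suc _)) _ = refl


  OnGirthCycle : V → V → Set
  OnGirthCycle x y = Σ (List V) λ r → GirthCycle (x ∷ y ∷ r)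

  onGirthCycle⇔ε>0 : ∀ {x y} → OnGirthCycle x y ⇔ 0 < ε Γ g x y
  onGirthCycle⇔ε>0 {x} {y} = mk⇔ to from
    where
    candidates : List (List V)
    candidates = map (λ r → x ∷ y ∷ r) (allLists Γ (g ∸ 2))
    to : OnGirthCycle x y → 0 < ε Γ g x y
    to (r , c , len) = member⇒nonempty {xs = filter (T? ∘ isCycle Γ) candidates}
      (∈-filter⁺ (T? ∘ isCycle Γ)
        (∈-map⁺ (λ r → x ∷ y ∷ r) (Equivalence.from (∈-allLists⇔ Γ (g ∸ 2) {r}) (suc-injective (suc-injective len))))
        (Equivalence.from (isCycle⇔ (x ∷ y ∷ r)) c))
    from : 0 < ε Γ g x y → OnGirthCycle x y
    from pos with nonempty⇒member (filter (T? ∘ isCycle Γ) candidates) pos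
    ... | Z , Z∈ with ∈-filter⁻ (T? ∘ isCycle Γ) {xs = candidates} Z∈
    ... | Z∈cand , cyc with ∈-map⁻ (λ r → x ∷ y ∷ r) Z∈cand
    ... | r , r∈ , refl =
      r , Equivalence.to (isCycle⇔ _) cyc , cong (suc ∘ suc) (Equivalence.to (∈-allLists⇔ Γ _) r∈)

  onGirthCycle-adj : ∀ {x y} → OnGirthCycle x y → x ~ y
  onGirthCycle-adj (_ , (_ , _ , a ∷ _) , _) = a

  girthCycle-rotate : ∀ A w B → GirthCycle (A ++ w ∷ B) → GirthCycle (w ∷ B ++ A)
  girthCycle-rotate A w B (c , len) =
    cycle-rotate A w B c , trans (sym (↭-length (++-comm A (w ∷ B)))) len

  girthCycle-reverse : ∀ y l → GirthCycle (y ∷ l) → GirthCycle (y ∷ reverse l)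
  girthCycle-reverse y l (c , len) =
    cycle-reverse y l c , trans (cong suc (length-reverse l)) len

  -- Rotate the cycle x y r to y r x and reverse it to y x (reverse r).
  onGirthCycle-sym : ∀ {x y} → OnGirthCycle x y → OnGirthCycle y x
  onGirthCycle-sym {x} {y} (r , gc) =
    reverse r ,
    subst (λ l → GirthCycle (y ∷ l)) (reverse-++ r (x ∷ []))
      (girthCycle-reverse y (r ∷ʳ x) (girthCycle-rotate (x ∷ []) y r gc))

  -- Consecutive vertices of a girth cycle are joined by girth-cycle edges,
  -- so every vertex of a girth cycle is reachable from its first one.
  girthCycle-connected : ∀ z A B → GirthCycle (z ∷ A ++ B) → ∀ {y} → y ∈ A → Star OnGirthCycle z y
  girthCycle-connected z (a ∷ A) B gc (here refl) = (A ++ B , gc) ◅ done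
  girthCycle-connected z (a ∷ A) B gc (there y∈A) = (A ++ B , gc) ◅ girthCycle-connected a A (B ∷ʳ z) rotated y∈A
    where
    rotated : GirthCycle (a ∷ A ++ B ∷ʳ z)
    rotated = subst (λ l → GirthCycle (a ∷ l)) (++-assoc A B (z ∷ [])) (girthCycle-rotate (z ∷ []) a (A ++ B) gc)

  girthCycle-neighbours : ∀ w q zs p → GirthCycle (w ∷ q ∷ zs ∷ʳ p) →
                          OnGirthCycle w q × OnGirthCycle w p × q ≢ p
  girthCycle-neighbours w q zs p gc@((_ , _ ∷ q∉ ∷ _ , _) , _) =
    (zs ∷ʳ p , gc) ,
    onGirthCycle-sym (q ∷ zs , girthCycle-rotate (w ∷ q ∷ zs) p [] gc) ,
    All.lookup q∉ (∈-++⁺ʳ zs (here refl))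

  onGirthCycle-map : (k : V → V) → (∀ {x y} → k x ≡ k y → x ≡ y) → (∀ {x y} → x ~ y → k x ~ k y) →
                     ∀ {x y} → OnGirthCycle x y → OnGirthCycle (k x) (k y)
  onGirthCycle-map k inj hom {x} {y} (r , c , len) =
    map k r , cycle-map k inj hom c , trans (length-map k (x ∷ y ∷ r)) len

module Signature011 {n : ℕ} (Γ : Graph n) (g : ℕ) (cubic : Cubic Γ)
                    (signature011 : GirthRegularWithSignature Γ g (0 ∷ 1 ∷ 1 ∷ [])) where
  open Cycles Γ
  open GirthCycles Γ g

  neighbours⇔ : ∀ {x y} → x ~ y ⇔ y ∈ neighbours Γ x
  neighbours⇔ {x} {y} = mk⇔ (∈-filter⁺ (T? ∘ Graph.adj Γ x) (∈-allFin y))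
                            (proj₂ ∘ ∈-filter⁻ (T? ∘ Graph.adj Γ x) {xs = allFin n})

  record Local (x : V) : Set where
    field
      mate p q : V
      nbrs     : ∀ {y} → x ~ y → y ∈ mate ∷ p ∷ q ∷ []
      mate-adj : x ~ mate
      mate-off : ¬ OnGirthCycle x mate
      p-on     : OnGirthCycle x p
      q-on     : OnGirthCycle x q
      p≢q      : p ≢ q

  opaque
    local : ∀ x → Local x
    local x = fromNeighbours (neighbours Γ x) (cubic x) (Unique.filter⁺ _ (Unique.allFin⁺ n))
                neighbours⇔ (signature011 x)
      where
      off : ∀ {y} → ε Γ g x y ≡ 0 → ¬ OnGirthCycle x y
      off ε≡0 on = <-irrefl refl (subst (0 <_) ε≡0 (Equivalence.to onGirthCycle⇔ε>0 on))
      on : ∀ {y} → ε Γ g x y ≡ 1 → OnGirthCycle x y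
      on ε≡1 = Equivalence.from onGirthCycle⇔ε>0 (subst (0 <_) (sym ε≡1) (s≤s z≤n))
      fromOrdered : ∀ {ns} m p q → Unique ns → (∀ {y} → x ~ y ⇔ y ∈ ns) → ns ↭ m ∷ p ∷ q ∷ [] →
                    ε Γ g x m ≡ 0 → ε Γ g x p ≡ 1 → ε Γ g x q ≡ 1 → Local x
      fromOrdered m p q u nb perm εm εp εq with unique-resp-↭ perm u
      ... | _ ∷ (p≢q ∷ []) ∷ _ = record
        { mate = m ; p = p ; q = q
        ; nbrs = ∈-resp-↭ perm ∘ Equivalence.to nb
        ; mate-adj = Equivalence.from nb (∈-resp-↭ (↭-sym perm) (here refl))
        ; mate-off = off εm ; p-on = on εp ; q-on = on εq ; p≢q = p≢q }
      fromNeighbours : ∀ ns → length ns ≡ 3 → Unique ns → (∀ {y} → x ~ y ⇔ y ∈ ns) →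
                       sort (map (ε Γ g x) ns) ≡ 0 ∷ 1 ∷ 1 ∷ [] → Local x
      fromNeighbours (a ∷ b ∷ c ∷ []) _ u nb sorted with sorted-011 _ _ _ sorted
      ... | inj₁ (εa , εb , εc)        = fromOrdered a b c u nb ↭-refl εa εb εc
      ... | inj₂ (inj₁ (εb , εa , εc)) = fromOrdered b a c u nb (shift b (a ∷ []) (c ∷ [])) εb εa εc
      ... | inj₂ (inj₂ (εc , εa , εb)) = fromOrdered c a b u nb (shift c (a ∷ b ∷ []) []) εc εa εb

  mate : V → V
  mate x = Local.mate (local x)

  girthNeighbour : ∀ {x y} → OnGirthCycle x y → y ≡ Local.p (local x) ⊎ y ≡ Local.q (local x)
  girthNeighbour {x} on with Local.nbrs (local x) (onGirthCycle-adj on)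
  ... | here refl                = ⊥-elim (Local.mate-off (local x) on)
  ... | there (here y≡p)         = inj₁ y≡p
  ... | there (there (here y≡q)) = inj₂ y≡q

  adjacent⇔ : ∀ {x y} → x ~ y ⇔ (OnGirthCycle x y ⊎ y ≡ mate x)
  adjacent⇔ {x} {y} = mk⇔ to from
    where
    open Local (local x) using (nbrs; p-on; q-on; mate-adj)
    to : x ~ y → OnGirthCycle x y ⊎ y ≡ mate x
    to adj with nbrs adj
    ... | here y≡m                 = inj₂ y≡m
    ... | there (here refl)        = inj₁ p-on
    ... | there (there (here refl)) = inj₁ q-on
    from : OnGirthCycle x y ⊎ y ≡ mate x → x ~ y
    from (inj₁ on)   = onGirthCycle-adj on
    from (inj₂ refl) = mate-adj

  mate-unique : ∀ {x y} → x ~ y → ¬ OnGirthCycle x y → y ≡ mate x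
  mate-unique adj off with Equivalence.to adjacent⇔ adj
  ... | inj₁ on   = ⊥-elim (off on)
  ... | inj₂ y≡m = y≡m

  mate-involutive : ∀ x → mate (mate x) ≡ x
  mate-involutive x = sym (mate-unique (~-sym (Local.mate-adj (local x)))
                                       (Local.mate-off (local x) ∘ onGirthCycle-sym))

  mate-fixfree : ∀ x → mate x ≢ x
  mate-fixfree x m≡x = subst T (Graph.irrefl Γ x) (subst (x ~_) m≡x (Local.mate-adj (local x)))

  girthCycle-closed : ∀ {Z w z} → GirthCycle Z → w ∈ Z → OnGirthCycle w z → z ∈ Z
  girthCycle-closed {Z} {w} {z} gc w∈Z on with ∈-∃++ w∈Z
  ... | A , B , refl = ∈-resp-↭ (↭-sym (++-comm A (w ∷ B)))
                         (there (afterHead (B ++ A) (girthCycle-rotate A w B gc)))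
    where
    afterHead : ∀ C → GirthCycle (w ∷ C) → z ∈ C
    afterHead [] ((s≤s () , _) , _)
    afterHead (u ∷ t) gc′ with reverseView t
    afterHead (u ∷ .[]) ((s≤s (s≤s ()) , _) , _) | []
    ... | zs ∶ _ ∶ʳ v with girthCycle-neighbours w u zs v gc′
    ... | on-u , on-v , u≢v with two-distinct-exhaust (girthNeighbour on-u) (girthNeighbour on-v) u≢v (girthNeighbour on)
    ... | inj₁ refl = here refl
    ... | inj₂ refl = there (∈-++⁺ʳ zs (here refl))

  cycleOf : V → List V
  cycleOf x = x ∷ Local.p (local x) ∷ proj₁ (Local.p-on (local x))

  cycleOf-girthCycle : ∀ x → GirthCycle (cycleOf x)
  cycleOf-girthCycle x = proj₂ (Local.p-on (local x))

  reachable⇔∈cycleOf : ∀ {x y} → Star OnGirthCycle x y ⇔ y ∈ cycleOf x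
  reachable⇔∈cycleOf {x} = mk⇔ (closed (here refl)) reach
    where
    closed : ∀ {w y} → w ∈ cycleOf x → Star OnGirthCycle w y → y ∈ cycleOf x
    closed w∈ done         = w∈
    closed w∈ (on ◅ steps) = closed (girthCycle-closed (cycleOf-girthCycle x) w∈ on) steps
    reach : ∀ {y} → y ∈ cycleOf x → Star OnGirthCycle x y
    reach (here refl) = done
    reach (there y∈)  = girthCycle-connected x (Local.p (local x) ∷ proj₁ (Local.p-on (local x))) []
                          (subst (λ l → GirthCycle (x ∷ l)) (sym (++-identityʳ _)) (cycleOf-girthCycle x)) y∈

  module _ (φ : Automorphism Γ) where
    open Inverse (Automorphism.perm φ) using (to; from; strictlyInverseʳ)

    onGirthCycle-automorphism⇔ : ∀ {x y} → OnGirthCycle x y ⇔ OnGirthCycle (to x) (to y)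
    onGirthCycle-automorphism⇔ {x} {y} = mk⇔
      (onGirthCycle-map to (automorphism-injective φ) (automorphism-hom φ))
      (subst₂ OnGirthCycle (strictlyInverseʳ x) (strictlyInverseʳ y) ∘
        onGirthCycle-map from (automorphism-injective (inverseAutomorphism φ))
                              (automorphism-hom (inverseAutomorphism φ)))

    mate-automorphism : ∀ x → mate (to x) ≡ to (mate x)
    mate-automorphism x = sym (mate-unique (automorphism-hom φ (Local.mate-adj (local x)))
      (Local.mate-off (local x) ∘ Equivalence.from onGirthCycle-automorphism⇔))

module Construction {n : ℕ} (Γ : Graph n) (g : ℕ) (cubic : Cubic Γ)
                    (signature011 : GirthRegularWithSignature Γ g (0 ∷ 1 ∷ 1 ∷ [])) where
  open Cycles Γ
  open GirthCycles Γ g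
  open Signature011 Γ g cubic signature011
  open import Data.List.Membership.DecPropositional (_≟_ {n}) using (_∈?_)

  -- Lying on a common girth cycle: a decidable equivalence relation whose classes
  -- are the girth cycles; they become the vertices of Λ.
  _≈_ : V → V → Set
  _≈_ = Star OnGirthCycle

  ≈-isEquivalence : IsEquivalence _≈_
  ≈-isEquivalence = record { refl = done ; sym = Star.reverse onGirthCycle-sym ; trans = _◅◅_ }

  open Quotient ≈-isEquivalence (λ x y → Dec.map (⇔-sym reachable⇔∈cycleOf) (y ∈? cycleOf x))

  -- The mate edges {x, mate x} become the edges of Λ; the vertex x of Γ is
  -- the arc of the edge {x, mate x} leaving the girth cycle of x.
  open InvolutionPairing mate mate-involutive mate-fixfree

  Λ : MultiGraph
  Λ = record { nV = classes ; nE = pairs ; ends = λ e → [ lowerOf e ] , [ mate (lowerOf e) ] }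

  tail-unpair : ∀ s → tail Λ s ≡ [ unpair s ]
  tail-unpair (e , false) = refl
  tail-unpair (e , true)  = refl

  unpair-inv : ∀ s → unpair (inv Λ s) ≡ mate (unpair s)
  unpair-inv (e , b) = unpair-flip e b

  pair-mate : ∀ x → pair (mate x) ≡ inv Λ (pair x)
  pair-mate x = trans (cong (pair ∘ mate) (sym (unpair-pair x)))
                      (trans (cong pair (sym (unpair-inv (pair x)))) (pair-unpair (inv Λ (pair x))))

  related : Arc Λ → Arc Λ → Bool
  related s t = 0 <ᵇ ε Γ g (unpair s) (unpair t)

  related⇔ : ∀ s t → T (related s t) ⇔ OnGirthCycle (unpair s) (unpair t)
  related⇔ s t = mk⇔ (Equivalence.from onGirthCycle⇔ε>0 ∘ <ᵇ⇒< 0 _)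
                     (<⇒<ᵇ ∘ Equivalence.to onGirthCycle⇔ε>0)

  related-pair⇔ : ∀ x y → T (related (pair x) (pair y)) ⇔ OnGirthCycle x y
  related-pair⇔ x y = subst₂ (λ u v → T (related (pair x) (pair y)) ⇔ OnGirthCycle u v)
                        (unpair-pair x) (unpair-pair y) (related⇔ (pair x) (pair y))

  related-pair⇔ʳ : ∀ s y → T (related s (pair y)) ⇔ OnGirthCycle (unpair s) y
  related-pair⇔ʳ s y = subst (λ v → T (related s (pair y)) ⇔ OnGirthCycle (unpair s) v)
                         (unpair-pair y) (related⇔ s (pair y))

  girthNeighbours⇔ : ∀ {x y} → OnGirthCycle x y ⇔ y ∈ Local.p (local x) ∷ Local.q (local x) ∷ []
  girthNeighbours⇔ {x} = mk⇔ to from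
    where
    open Local (local x) using (p; q; p-on; q-on)
    to : ∀ {y} → OnGirthCycle x y → y ∈ p ∷ q ∷ []
    to on with girthNeighbour on
    ... | inj₁ y≡p = here y≡p
    ... | inj₂ y≡q = there (here y≡q)
    from : ∀ {y} → y ∈ p ∷ q ∷ [] → OnGirthCycle x y
    from (here refl)         = p-on
    from (there (here refl)) = q-on

  -- Each arc is related to exactly two arcs, those of the two girth-cycle neighbours.
  twoRegular : ∀ s → length (filter (λ t → T? (related s t)) (allArcs Λ)) ≡ 2
  twoRegular s = ArcCounting.count-arcs Λ pairing (λ t → T? (related s t))
                   ((Local.p≢q (local (unpair s)) ∷ []) ∷ [] ∷ [])
                   (λ {y} → girthNeighbours⇔ ⇔-∘ related-pair⇔ʳ s y)

  components : ∀ s t → Star (λ a b → T (related a b)) s t ⇔ (tail Λ s ≡ tail Λ t)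
  components s t = mk⇔ to from
    where
    to : Star (λ a b → T (related a b)) s t → tail Λ s ≡ tail Λ t
    to path = trans (tail-unpair s)
                (trans ([]-cong (gmap unpair (λ {a} {b} → Equivalence.to (related⇔ a b)) path)) (sym (tail-unpair t)))
    from : tail Λ s ≡ tail Λ t → Star (λ a b → T (related a b)) s t
    from tails = subst₂ (Star _) (pair-unpair s) (pair-unpair t)
      (gmap pair (λ {x} {y} → Equivalence.from (related-pair⇔ x y))
        ([]-injective (trans (sym (tail-unpair s)) (trans tails (tail-unpair t)))))

  scheme : DihedralScheme Λ
  scheme = record
    { rel        = related
    ; irrefl     = λ s → T-⇔⇒≡ (mk⇔ (noLoop ∘ Equivalence.to (related⇔ s s)) (λ ()))
    ; sym        = λ s t → T-⇔⇒≡ (⇔-sym (related⇔ t s) ⇔-∘ (onGirthCycle-sym⇔ ⇔-∘ related⇔ s t))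
    ; twoRegular = twoRegular
    ; components = components
    }
    where
    noLoop : ∀ {x} → OnGirthCycle x x → ⊥
    noLoop {x} on = subst T (Graph.irrefl Γ x) (onGirthCycle-adj on)
    onGirthCycle-sym⇔ : ∀ {x y} → OnGirthCycle x y ⇔ OnGirthCycle y x
    onGirthCycle-sym⇔ = mk⇔ onGirthCycle-sym onGirthCycle-sym

  outArcs⇔ : ∀ u {y} → (tail Λ (pair y) ≡ u) ⇔ y ∈ cycleOf (choose u)
  outArcs⇔ u {y} = mk⇔
    (λ e → Equivalence.to reachable⇔∈cycleOf (Star.reverse onGirthCycle-sym
             ([]-injective (trans (sym (tail≡ y)) (trans e (sym ([]-choose u)))))))
    (λ y∈ → trans (tail≡ y) (trans ([]-cong (Star.reverse onGirthCycle-sym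
               (Equivalence.from reachable⇔∈cycleOf y∈))) ([]-choose u)))
    where
    tail≡ : ∀ y → tail Λ (pair y) ≡ [ y ]
    tail≡ y = trans (tail-unpair (pair y)) (cong [_] (unpair-pair y))

  -- Every vertex of Λ has g out-arcs, one per vertex of a girth cycle.
  regular : Regular Λ g
  regular u = trans (ArcCounting.count-arcs Λ pairing (λ s → tail Λ s ≟ u)
                       (proj₁ (proj₂ (proj₁ cycle))) (outArcs⇔ u))
                    (girthCycle-length cycle)
    where
    cycle : GirthCycle (cycleOf (choose u))
    cycle = cycleOf-girthCycle (choose u)

  adjacent⇔truncation : ∀ x y → x ~ y ⇔ T (trAdj Λ scheme (pair x) (pair y))
  adjacent⇔truncation x y = mk⇔
    (λ adj → Equivalence.from T-∨ (Sum.map (Equivalence.from (related-pair⇔ x y)) mateArc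
                                             (Equivalence.to adjacent⇔ adj)))
    (λ tr → Equivalence.from adjacent⇔ (Sum.map (Equivalence.to (related-pair⇔ x y)) arcMate
                                                  (Equivalence.to T-∨ tr)))
    where
    inverse⇔ : T (areInverse Λ (pair x) (pair y)) ⇔ (pair y ≡ inv Λ (pair x))
    inverse⇔ = ArcCounting.areInverse⇔ Λ (pair x) (pair y)
    mateArc : y ≡ mate x → T (areInverse Λ (pair x) (pair y))
    mateArc refl = Equivalence.from inverse⇔ (pair-mate x)
    arcMate : T (areInverse Λ (pair x) (pair y)) → y ≡ mate x
    arcMate inverse = begin
      y                         ≡⟨ sym (unpair-pair y) ⟩
      unpair (pair y)           ≡⟨ cong unpair (Equivalence.to inverse⇔ inverse) ⟩
      unpair (inv Λ (pair x))   ≡⟨ unpair-inv (pair x) ⟩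
      mate (unpair (pair x))    ≡⟨ cong mate (unpair-pair x) ⟩
      mate x                    ∎
      where open ≡-Reasoning

  truncationIso : IsoToTruncation Γ Λ scheme
  truncationIso = pairing , λ x y → T-⇔⇒≡ (adjacent⇔truncation x y)

  module _ (φ : Automorphism Γ) where
    open Inverse (Automorphism.perm φ) using (to; from; strictlyInverseˡ)

    [to-choose] : ∀ x → [ to (choose [ x ]) ] ≡ [ to x ]
    [to-choose] x = []-cong (gmap to (Equivalence.to (onGirthCycle-automorphism⇔ φ)) (choose-[] x))

    vertexRoundTrip : ∀ u → [ to (choose [ from (choose u) ]) ] ≡ u
    vertexRoundTrip u = begin
      [ to (choose [ from (choose u) ]) ] ≡⟨ [to-choose] (from (choose u)) ⟩
      [ to (from (choose u)) ]            ≡⟨ cong [_] (strictlyInverseˡ (choose u)) ⟩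
      [ choose u ]                        ≡⟨ []-choose u ⟩
      u                                   ∎
      where open ≡-Reasoning

  schemeAutomorphism : Automorphism Γ → SchemeAutomorphism Λ scheme
  schemeAutomorphism φ = record
    { onArcs     = pairing ↔-∘ (Automorphism.perm φ ↔-∘ ↔-sym pairing)
    ; onVertices = mk↔ₛ′ (λ u → [ to (choose u) ]) (λ u → [ from (choose u) ])
                         (vertexRoundTrip φ) (vertexRoundTrip (inverseAutomorphism φ))
    ; tailComm   = tailComm
    ; invComm    = invComm
    ; preserve   = λ s t → T-⇔⇒≡
        (⇔-sym (related-pair⇔ (to (unpair s)) (to (unpair t)))
          ⇔-∘ (onGirthCycle-automorphism⇔ φ ⇔-∘ related⇔ s t))
    }
    where
    open Inverse (Automorphism.perm φ) using (to; from)
    tailComm : ∀ s → tail Λ (pair (to (unpair s))) ≡ [ to (choose (tail Λ s)) ]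
    tailComm s = begin
      tail Λ (pair (to (unpair s)))    ≡⟨ tail-unpair (pair (to (unpair s))) ⟩
      [ unpair (pair (to (unpair s))) ] ≡⟨ cong [_] (unpair-pair (to (unpair s))) ⟩
      [ to (unpair s) ]                ≡⟨ sym ([to-choose] φ (unpair s)) ⟩
      [ to (choose [ unpair s ]) ]     ≡⟨ cong (λ u → [ to (choose u) ]) (sym (tail-unpair s)) ⟩
      [ to (choose (tail Λ s)) ]       ∎
      where open ≡-Reasoning
    invComm : ∀ s → pair (to (unpair (inv Λ s))) ≡ inv Λ (pair (to (unpair s)))
    invComm s = begin
      pair (to (unpair (inv Λ s)))  ≡⟨ cong (pair ∘ to) (unpair-inv s) ⟩
      pair (to (mate (unpair s)))   ≡⟨ cong pair (sym (mate-automorphism φ (unpair s))) ⟩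
      pair (mate (to (unpair s)))   ≡⟨ pair-mate (to (unpair s)) ⟩
      inv Λ (pair (to (unpair s)))  ∎
      where open ≡-Reasoning

  arcTransitive : VertexTransitive Γ → ArcTransitive Λ scheme
  arcTransitive vt s t with vt (unpair s) (unpair t)
  ... | φ , φs≡t = schemeAutomorphism φ , trans (cong pair φs≡t) (pair-unpair t)

-- The truncation of the cycle multigraph Λ is Γ; vertex-transitivity of Γ
-- makes the scheme arc-transitive.
theorem3p6 : (n : ℕ) (Γ : Graph n) (g : ℕ) →
    Cubic Γ → Girth Γ g → GirthRegularWithSignature Γ g (0 ∷ 1 ∷ 1 ∷ []) →
    TruncationOfRegular Γ g × (VertexTransitive Γ → ArcTransitiveTruncationOfRegular Γ g)
theorem3p6 n Γ g cubic _ signature011 =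
  (Λ , regular , scheme , truncationIso) ,
  λ vertexTransitive → Λ , regular , scheme , arcTransitive vertexTransitive , truncationIso
  where open Construction Γ g cubic signature011
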